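{- Let $T$ be a tree on the vertex set $\{0,1,\ldots,n\}$ with vertex Laplacian $L$, and suppose $n$ is a leaf of $T$. Let $L_n$ be $L$ with row $n$ and column $n$ deleted, and let $\mathcal{C}=\{\lambda\in\mathbb{R}^n : L_n\lambda\ge 0\}$ (componentwise). Define \[\sigma_{\mathcal{C}}(q)=\sum_{\lambda\in\mathcal{C}\cap\mathbb{Z}^n} q^{\lambda_0+\lambda_1+\cdots+\lambda_{n-1}}.\] Then \[\sigma_{\mathcal{C}}(q)=\frac{1}{\prod_{i=0}^{n-1}(1-q^{b_i})},\] where $b_i=\sum_{j=0}^{n-1} d(i,j)$ and $d(i,j)$ denotes the distance from vertex $n$ to the path in $T$ connecting vertices $i$ and $j$ (for $j=i$ this path is the single vertex $i$).
   Context: The vertex Laplacian of a simple graph is $L=D-A$, with $D$ the diagonal degree matrix and $A$ the $0/1$ adjacency matrix, indexed by the vertices. Distance means number of edges. -}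

module Defs where

open import Data.Nat as ℕ using (ℕ; zero; suc)
open import Data.Integer as ℤ using (ℤ; +_)
open import Data.Fin using (Fin; zero; suc; fromℕ; inject₁)
open import Data.Bool using (Bool; true; false; if_then_else_)
open import Data.List using (List; []; _∷_)
open import Data.List.Relation.Unary.Unique.Propositional using (Unique)
open import Data.List.Membership.Propositional using (_∈_)
open import Data.Vec using (Vec; lookup)
open import Data.Product using (Σ; ∃; _×_; _,_)
open import Relation.Binary.PropositionalEquality using (_≡_)
open import Relation.Nullary using (¬_; does)
open import Data.Fin using (_≟_)

∑ℕ : ∀ {m} → (Fin m → ℕ) → ℕ
∑ℕ {zero} f = 0
∑ℕ {suc m} f = f zero ℕ.+ ∑ℕ (λ i → f (suc i))

∑ℤ : ∀ {m} → (Fin m → ℤ) → ℤ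
∑ℤ {zero} f = + 0
∑ℤ {suc m} f = f zero ℤ.+ ∑ℤ (λ i → f (suc i))

record Graph (m : ℕ) : Set where
  field
    adj   : Fin m → Fin m → Bool
    sym   : ∀ u v → adj u v ≡ adj v u
    irrfl : ∀ u → adj u u ≡ false

module _ {m : ℕ} (G : Graph m) where
  open Graph G

  data Walk : Fin m → Fin m → ℕ → Set where
    [_]  : ∀ u → Walk u u 0
    _∷⟨_⟩_ : ∀ u {w v k} → adj u w ≡ true → Walk w v k → Walk u v (suc k)

  verts : ∀ {u v k} → Walk u v k → List (Fin m)
  verts [ u ] = u ∷ []
  verts (u ∷⟨ _ ⟩ p) = u ∷ verts p

  IsPath : ∀ {u v k} → Walk u v k → Set
  IsPath p = Unique (verts p)

  Connected : Set
  Connected = ∀ u v → ∃ λ k → Walk u v k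

  -- a cycle: a path u … v with at least 2 edges (≥ 3 vertices) plus an edge v u
  Acyclic : Set
  Acyclic = ∀ u v k (p : Walk u v (suc (suc k))) → IsPath p → ¬ (adj v u ≡ true)

  IsTree : Set
  IsTree = Connected × Acyclic

  degree : Fin m → ℕ
  degree u = ∑ℕ (λ v → if adj u v then 1 else 0)

  IsLeaf : Fin m → Set
  IsLeaf u = degree u ≡ 1

  laplacian : Fin m → Fin m → ℤ
  laplacian u v =
    if does (u ≟ v) then + degree u
    else ℤ.- (if adj u v then + 1 else + 0)

  Dist : Fin m → Fin m → ℕ → Set
  Dist u v k = Walk u v k × (∀ k′ → Walk u v k′ → k ℕ.≤ k′)

  -- DistToPath x i j k : the distance from x to the path connecting i and j is k
  -- (in a tree this path is unique; for i = j it is the single vertex i)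
  DistToPath : Fin m → Fin m → Fin m → ℕ → Set
  DistToPath x i j k =
    Σ ℕ λ l → Σ (Walk i j l) λ P → IsPath P ×
      ((∃ λ w → w ∈ verts P × Dist x w k) ×
       (∀ w → w ∈ verts P → ∀ k′ → Dist x w k′ → k ℕ.≤ k′))

record BijectionOn {A B : Set} (P : A → Set) (Q : B → Set) : Set where
  field
    to       : A → B
    from     : B → A
    to-∈     : ∀ x → P x → Q (to x)
    from-∈   : ∀ y → Q y → P (from y)
    from∘to  : ∀ x → P x → from (to x) ≡ x
    to∘from  : ∀ y → Q y → to (from y) ≡ y

-- Coefficient set of q^s in σ_C(q): integer points λ of the cone L_n λ ≥ 0 with Σ λ = s
-- (vertices 0..n-1 are inject₁ i, vertex n is fromℕ n)
ConePoint : ∀ {n} → Graph (suc n) → ℤ → Vec ℤ n → Set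
ConePoint {n} T s λv =
  (∀ (i : Fin n) → + 0 ℤ.≤ ∑ℤ (λ j → laplacian T (inject₁ i) (inject₁ j) ℤ.* lookup λv j))
  × ∑ℤ (lookup λv) ≡ s

-- Coefficient set of q^s in 1/∏(1 - q^{b_i}) = ∏ Σ_{k≥0} q^{k b_i}:
-- tuples (k_0..k_{n-1}) of naturals with Σ k_i b_i = s
ProductPoint : ∀ {n} → (Fin n → ℕ) → ℤ → Vec ℕ n → Set
ProductPoint b s kv = + ∑ℕ (λ i → lookup kv i ℕ.* b i) ≡ s

-- Root T at r = n.  The hypothesis on d says that d i j is the depth of the meet (deepest common
-- ancestor) of i and j; in particular d i i is the depth of i.  Fix k and let G v be the depth of
-- the meet of v and k.  Along the edge from v to its parent, G drops by one if v lies on the path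
-- from r to k and is constant otherwise.  So for i ≠ r, summing G i − G j over the neighbours j
-- of i (its parent and its children) gives [i lies on the path to k] − [i lies on it strictly
-- before k] = δ i k: the matrix D = (d i j) is the inverse of the reduced Laplacian L.  Hence
-- λ ↦ L λ maps the integer points of the cone bijectively onto ℕⁿ, with inverse κ ↦ D κ, and
-- Σ_i (D κ)_i = Σ_l κ_l b_l because D is symmetric with row sums b.

module Submission where

open import Defs
open import Data.Nat as ℕ using (ℕ; zero; suc; _≤_; _<_; _∸_; z≤n; s≤s)
import Data.Nat.Properties as ℕ
open import Data.Nat.GeneralisedArithmetic using (iterate)
open import Data.Integer as ℤ using (ℤ; +_; 0ℤ; 1ℤ; _+_; _*_; -_; _-_; ∣_∣; +≤+)
import Data.Integer.Properties as ℤ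
open import Data.Integer.Tactic.RingSolver using (solve-∀)
open import Data.Fin using (Fin; zero; suc; fromℕ; inject₁; punchIn; _≟_)
open import Data.Fin.Properties using (punchInᵢ≢i; inject₁-injective; fromℕ≢inject₁)
open import Data.Fin.Relation.Unary.Top using (view; ‵fromℕ; ‵inject₁; view-inject₁; view-fromℕ)
open import Data.Vec using (Vec; lookup; tabulate)
import Data.Vec.Properties as Vec
open import Data.Bool using (true; false; if_then_else_)
open import Data.List using (_++_; _∷_; [])
open import Data.List.Relation.Unary.All as All using (All; []; _∷_)
import Data.List.Relation.Unary.All.Properties as All
open import Data.List.Relation.Unary.Any using (here; there)
open import Data.List.Relation.Unary.AllPairs using ([]; _∷_)
import Data.List.Relation.Unary.AllPairs.Properties as AllPairs
open import Data.List.Membership.Propositional using (_∈_)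
open import Data.Product using (Σ; _×_; _,_; proj₁; proj₂)
open import Data.Sum using (_⊎_; inj₁; inj₂)
open import Function using (_∘_)
open import Function.Bundles using (_⇔_; mk⇔)
open import Relation.Binary using (tri<; tri≈; tri>)
open import Relation.Binary.PropositionalEquality hiding ([_])
open import Relation.Nullary using (¬_; Dec; yes; no; does; contradiction)
open import Relation.Nullary.Decidable using (_×-dec_; dec-true; dec-false; does-⇔)
open import Algebra.Properties.Semiring.Sum ℤ.+-*-semiring
  using (sum; sum-cong-≗; ∑-distrib-+; ∑-comm; *-distribˡ-sum; *-distribʳ-sum;
         sum-init-last; sum-remove; sum-replicate-zero)

private variable m n : ℕ

∑ℤ≡sum : (f : Fin m → ℤ) → ∑ℤ f ≡ sum f
∑ℤ≡sum {zero}  f = refl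
∑ℤ≡sum {suc m} f = cong (λ t → f zero + t) (∑ℤ≡sum (f ∘ suc))

+∑ℕ≡sum : (f : Fin m → ℕ) → + ∑ℕ f ≡ sum (+_ ∘ f)
+∑ℕ≡sum {zero}  f = refl
+∑ℕ≡sum {suc m} f =
  trans (ℤ.pos-+ (f zero) _) (cong (λ t → + f zero + t) (+∑ℕ≡sum (f ∘ suc)))

sum-neg : (f : Fin m → ℤ) → sum (λ i → - f i) ≡ - sum f
sum-neg {zero}  f = refl
sum-neg {suc m} f =
  trans (cong (λ t → - f zero + t) (sum-neg (f ∘ suc))) (sym (ℤ.neg-distrib-+ (f zero) _))

sum-distrib-- : (f g : Fin m → ℤ) → sum (λ i → f i - g i) ≡ sum f - sum g
sum-distrib-- f g = trans (∑-distrib-+ f (λ i → - g i)) (cong (λ t → sum f + t) (sum-neg g))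

𝟙 : {P : Set} → Dec P → ℤ
𝟙 p? = if does p? then 1ℤ else 0ℤ

𝟙-yes : {P : Set} (p? : Dec P) → P → 𝟙 p? ≡ 1ℤ
𝟙-yes p? p rewrite dec-true p? p = refl

𝟙-no : {P : Set} (p? : Dec P) → ¬ P → 𝟙 p? ≡ 0ℤ
𝟙-no p? ¬p rewrite dec-false p? ¬p = refl

𝟙-⇔ : {P Q : Set} → P ⇔ Q → (p? : Dec P) (q? : Dec Q) → 𝟙 p? ≡ 𝟙 q?
𝟙-⇔ P⇔Q p? q? = cong (if_then 1ℤ else 0ℤ) (does-⇔ P⇔Q p? q?)

𝟙-×-dec : {P Q : Set} (p? : Dec P) (q? : Dec Q) → 𝟙 (p? ×-dec q?) ≡ 𝟙 p? * 𝟙 q?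
𝟙-×-dec (yes _) (yes _) = refl
𝟙-×-dec (yes _) (no _)  = refl
𝟙-×-dec (no _)  _       = refl

δ : Fin m → Fin m → ℤ
δ a b = 𝟙 (a ≟ b)

δ-sym : (a b : Fin m) → δ a b ≡ δ b a
δ-sym a b = 𝟙-⇔ (mk⇔ sym sym) (a ≟ b) (b ≟ a)

δ-inject₁ : (a b : Fin m) → δ (inject₁ a) (inject₁ b) ≡ δ a b
δ-inject₁ a b = 𝟙-⇔ (mk⇔ inject₁-injective (cong inject₁)) (inject₁ a ≟ inject₁ b) (a ≟ b)

sum-δ : (a : Fin m) (x : Fin m → ℤ) → sum (λ b → δ a b * x b) ≡ x a
sum-δ {suc m} a x = begin
  sum (λ b → δ a b * x b)
    ≡⟨ sum-remove {i = a} (λ b → δ a b * x b) ⟩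
  δ a a * x a + sum (λ b → δ a (punchIn a b) * x (punchIn a b))
    ≡⟨ cong₂ _+_ (cong (_* x a) (𝟙-yes (a ≟ a) refl))
                 (trans (sum-cong-≗ elsewhere) (sum-replicate-zero m)) ⟩
  1ℤ * x a + 0ℤ
    ≡⟨ trans (ℤ.+-identityʳ _) (ℤ.*-identityˡ _) ⟩
  x a ∎
  where
  open ≡-Reasoning
  elsewhere : ∀ b → δ a (punchIn a b) * x (punchIn a b) ≡ 0ℤ
  elsewhere b = trans (cong (_* x (punchIn a b)) (𝟙-no (a ≟ punchIn a b) (punchInᵢ≢i a b ∘ sym)))
                      (ℤ.*-zeroˡ (x (punchIn a b)))

infixr 7 _·_

_·_ : ∀ {p q} → (Fin p → Fin q → ℤ) → (Fin q → ℤ) → Fin p → ℤ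
(M · x) i = sum (λ j → M i j * x j)

·-· : ∀ {p q o} (M : Fin p → Fin q → ℤ) (N : Fin q → Fin o → ℤ) (x : Fin o → ℤ) →
      M · N · x ≗ (λ i l → sum (λ j → M i j * N j l)) · x
·-· M N x i = begin
  sum (λ j → M i j * sum (λ l → N j l * x l))
    ≡⟨ sum-cong-≗ (λ j → *-distribˡ-sum (M i j) (λ l → N j l * x l)) ⟩
  sum (λ j → sum (λ l → M i j * (N j l * x l)))
    ≡⟨ ∑-comm (λ j l → M i j * (N j l * x l)) ⟩
  sum (λ l → sum (λ j → M i j * (N j l * x l)))
    ≡⟨ sum-cong-≗ (λ l → sum-cong-≗ (λ j → sym (ℤ.*-assoc (M i j) (N j l) (x l)))) ⟩
  sum (λ l → sum (λ j → M i j * N j l * x l))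
    ≡⟨ sum-cong-≗ (λ l → *-distribʳ-sum (x l) (λ j → M i j * N j l)) ⟨
  sum (λ l → sum (λ j → M i j * N j l) * x l) ∎
  where open ≡-Reasoning

·-inverse : ∀ {p q} (M : Fin p → Fin q → ℤ) (N : Fin q → Fin p → ℤ) →
            (∀ i l → sum (λ j → M i j * N j l) ≡ δ i l) → ∀ x → M · N · x ≗ x
·-inverse M N MN≡δ x i =
  trans (·-· M N x i) (trans (sum-cong-≗ λ l → cong (_* x l) (MN≡δ i l)) (sum-δ i x))

module SymmetricInverse {n} (L : Fin n → Fin n → ℤ) (L-sym : ∀ i j → L i j ≡ L j i)
    (d : Fin n → Fin n → ℕ) (d-sym : ∀ i j → d i j ≡ d j i)
    (L·d≡δ : ∀ i l → sum (λ j → L i j * + d j l) ≡ δ i l) where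

  D : Fin n → Fin n → ℤ
  D i j = + d i j

  b : Fin n → ℕ
  b i = ∑ℕ (λ j → d i j)

  Cone : ℤ → Vec ℤ n → Set
  Cone s λv = (∀ i → + 0 ℤ.≤ ∑ℤ (λ j → L i j * lookup λv j)) × ∑ℤ (lookup λv) ≡ s

  D·L≡δ : ∀ i l → sum (λ j → D i j * L j l) ≡ δ i l
  D·L≡δ i l = begin
    sum (λ j → D i j * L j l)  ≡⟨ sum-cong-≗ (λ j → trans (ℤ.*-comm (D i j) (L j l))
                                    (cong₂ _*_ (L-sym j l) (cong +_ (d-sym i j)))) ⟩
    sum (λ j → L l j * D j i)  ≡⟨ L·d≡δ l i ⟩
    δ l i                      ≡⟨ δ-sym l i ⟩
    δ i l                      ∎
    where open ≡-Reasoning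

  sum-D· : ∀ x → sum (D · x) ≡ sum (λ l → + b l * x l)
  sum-D· x = begin
    sum (λ i → sum (λ l → D i l * x l))  ≡⟨ ∑-comm (λ i l → D i l * x l) ⟩
    sum (λ l → sum (λ i → D i l * x l))  ≡⟨ sum-cong-≗ (λ l → *-distribʳ-sum (x l) (λ i → D i l)) ⟨
    sum (λ l → sum (λ i → D i l) * x l)  ≡⟨ sum-cong-≗ (λ l → cong (_* x l) column-sum) ⟩
    sum (λ l → + b l * x l)              ∎
    where
    open ≡-Reasoning
    column-sum : ∀ {l} → sum (λ i → D i l) ≡ + b l
    column-sum {l} = trans (sum-cong-≗ λ i → cong +_ (d-sym i l)) (sym (+∑ℕ≡sum (d l)))

  +∑ℕ-weighted : (κ : Fin n → ℕ) → + ∑ℕ (λ i → κ i ℕ.* b i) ≡ sum (λ i → + b i * + κ i)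
  +∑ℕ-weighted κ = trans (+∑ℕ≡sum (λ i → κ i ℕ.* b i))
                         (sum-cong-≗ λ i → trans (ℤ.pos-* (κ i) (b i)) (ℤ.*-comm (+ κ i) (+ b i)))

  cone-to-product : Vec ℤ n → Vec ℕ n
  cone-to-product λv = tabulate (λ i → ∣ (L · lookup λv) i ∣)

  product-to-cone : Vec ℕ n → Vec ℤ n
  product-to-cone κ = tabulate (D · (+_ ∘ lookup κ))

  +cone-to-product : ∀ {s} λv → Cone s λv → +_ ∘ lookup (cone-to-product λv) ≗ L · lookup λv
  +cone-to-product λv (nonneg , _) i =
    trans (cong +_ (Vec.lookup∘tabulate (λ i → ∣ (L · lookup λv) i ∣) i))
          (ℤ.0≤i⇒+∣i∣≡i (subst (+ 0 ℤ.≤_) (∑ℤ≡sum (λ j → L i j * lookup λv j)) (nonneg i)))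

  L·product-to-cone : ∀ κ → L · lookup (product-to-cone κ) ≗ +_ ∘ lookup κ
  L·product-to-cone κ i =
    trans (sum-cong-≗ λ j → cong (L i j *_) (Vec.lookup∘tabulate (D · (+_ ∘ lookup κ)) j))
          (·-inverse L D L·d≡δ (+_ ∘ lookup κ) i)

  cone-to-product-∈ : ∀ {s} λv → Cone s λv → ProductPoint b s (cone-to-product λv)
  cone-to-product-∈ {s} λv cone@(_ , sum≡s) = begin
    + ∑ℕ (λ i → lookup κ i ℕ.* b i)
      ≡⟨ +∑ℕ-weighted (lookup κ) ⟩
    sum (λ i → + b i * + lookup κ i)
      ≡⟨ sum-cong-≗ (λ i → cong (+ b i *_) (+cone-to-product λv cone i)) ⟩
    sum (λ i → + b i * (L · lookup λv) i)
      ≡⟨ sum-D· (L · lookup λv) ⟨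
    sum (D · L · lookup λv)
      ≡⟨ sum-cong-≗ (·-inverse D L D·L≡δ (lookup λv)) ⟩
    sum (lookup λv)
      ≡⟨ trans (sym (∑ℤ≡sum (lookup λv))) sum≡s ⟩
    s ∎
    where
    open ≡-Reasoning
    κ = cone-to-product λv

  product-to-cone-∈ : ∀ {s} κ → ProductPoint b s κ → Cone s (product-to-cone κ)
  product-to-cone-∈ {s} κ weighted≡s = nonneg , sum≡s
    where
    open ≡-Reasoning
    λv = product-to-cone κ
    nonneg : ∀ i → + 0 ℤ.≤ ∑ℤ (λ j → L i j * lookup λv j)
    nonneg i = subst (+ 0 ℤ.≤_) (sym (trans (∑ℤ≡sum (λ j → L i j * lookup λv j)) (L·product-to-cone κ i)))
                     (+≤+ z≤n)
    sum≡s : ∑ℤ (lookup λv) ≡ s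
    sum≡s = begin
      ∑ℤ (lookup λv)                    ≡⟨ ∑ℤ≡sum (lookup λv) ⟩
      sum (lookup λv)                   ≡⟨ sum-cong-≗ (Vec.lookup∘tabulate (D · (+_ ∘ lookup κ))) ⟩
      sum (D · (+_ ∘ lookup κ))         ≡⟨ sum-D· (+_ ∘ lookup κ) ⟩
      sum (λ l → + b l * + lookup κ l)  ≡⟨ +∑ℕ-weighted (lookup κ) ⟨
      + ∑ℕ (λ l → lookup κ l ℕ.* b l)   ≡⟨ weighted≡s ⟩
      s                                 ∎

  product-to-cone∘cone-to-product : ∀ {s} λv → Cone s λv → product-to-cone (cone-to-product λv) ≡ λv
  product-to-cone∘cone-to-product λv cone = trans (Vec.tabulate-cong λ i → begin
      (D · (+_ ∘ lookup (cone-to-product λv))) i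
        ≡⟨ sum-cong-≗ (λ l → cong (D i l *_) (+cone-to-product λv cone l)) ⟩
      (D · L · lookup λv) i
        ≡⟨ ·-inverse D L D·L≡δ (lookup λv) i ⟩
      lookup λv i ∎)
    (Vec.tabulate∘lookup λv)
    where open ≡-Reasoning

  cone-to-product∘product-to-cone : ∀ κ → cone-to-product (product-to-cone κ) ≡ κ
  cone-to-product∘product-to-cone κ =
    trans (Vec.tabulate-cong λ i → cong ∣_∣ (L·product-to-cone κ i)) (Vec.tabulate∘lookup κ)

  bijection : ∀ s → BijectionOn (Cone s) (ProductPoint b s)
  bijection s = record
    { to      = cone-to-product
    ; from    = product-to-cone
    ; to-∈    = cone-to-product-∈
    ; from-∈  = product-to-cone-∈
    ; from∘to = product-to-cone∘cone-to-product
    ; to∘from = λ κ _ → cone-to-product∘product-to-cone κ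
    }

module Laplacian (G : Graph m) where
  open Graph G renaming (sym to adj-sym)

  adjℤ : Fin m → Fin m → ℤ
  adjℤ u v = if adj u v then 1ℤ else 0ℤ

  degree≡sum-adjℤ : ∀ u → + degree G u ≡ sum (adjℤ u)
  degree≡sum-adjℤ u =
    trans (+∑ℕ≡sum (λ v → if adj u v then 1 else 0)) (sum-cong-≗ (λ v → +-if (adj u v)))
    where
    +-if : ∀ b → + (if b then 1 else 0) ≡ (if b then 1ℤ else 0ℤ)
    +-if true  = refl
    +-if false = refl

  laplacian≡ : ∀ u v → laplacian G u v ≡ δ u v * + degree G u - adjℤ u v
  laplacian≡ u v with u ≟ v
  ... | yes refl rewrite irrfl u = sym (ring (+ degree G u))
    where
    ring : ∀ a → 1ℤ * a - 0ℤ ≡ a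
    ring = solve-∀
  ... | no _ = sym (ring (+ degree G u) (adjℤ u v))
    where
    ring : ∀ a b → 0ℤ * a - b ≡ - b
    ring = solve-∀

  laplacian-sym : ∀ u v → laplacian G u v ≡ laplacian G v u
  laplacian-sym u v with u ≟ v | v ≟ u
  ... | yes refl | yes _   = refl
  ... | no _     | no _    = cong (λ b → - (if b then 1ℤ else 0ℤ)) (adj-sym u v)
  ... | yes u≡v  | no v≢u  = contradiction (sym u≡v) v≢u
  ... | no u≢v   | yes v≡u = contradiction (sym v≡u) u≢v

  laplacian-row : ∀ u (x : Fin m → ℤ) →
    sum (λ v → laplacian G u v * x v) ≡ sum (λ v → adjℤ u v * (x u - x v))
  laplacian-row u x = begin
    sum (λ v → laplacian G u v * x v)
      ≡⟨ sum-cong-≗ (λ v → trans (cong (_* x v) (laplacian≡ u v)) (distribʳ (δ u v) _ _ (x v))) ⟩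
    sum (λ v → δ u v * (+ degree G u * x v) - adjℤ u v * x v)
      ≡⟨ sum-distrib-- (λ v → δ u v * (+ degree G u * x v)) (λ v → adjℤ u v * x v) ⟩
    sum (λ v → δ u v * (+ degree G u * x v)) - Ax
      ≡⟨ cong (_- Ax) (sum-δ u (λ v → + degree G u * x v)) ⟩
    + degree G u * x u - Ax
      ≡⟨ cong (λ t → t * x u - Ax) (degree≡sum-adjℤ u) ⟩
    sum (adjℤ u) * x u - Ax
      ≡⟨ cong (_- Ax) (*-distribʳ-sum (x u) (adjℤ u)) ⟩
    sum (λ v → adjℤ u v * x u) - Ax
      ≡⟨ sum-distrib-- (λ v → adjℤ u v * x u) (λ v → adjℤ u v * x v) ⟨
    sum (λ v → adjℤ u v * x u - adjℤ u v * x v)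
      ≡⟨ sum-cong-≗ (λ v → distribˡ (adjℤ u v) (x u) (x v)) ⟨
    sum (λ v → adjℤ u v * (x u - x v)) ∎
    where
    open ≡-Reasoning
    Ax = sum (λ v → adjℤ u v * x v)
    distribʳ : ∀ a b c y → (a * b - c) * y ≡ a * (b * y) - c * y
    distribʳ = solve-∀
    distribˡ : ∀ a y z → a * (y - z) ≡ a * y - a * z
    distribˡ = solve-∀

module Walks (G : Graph m) where
  open Graph G

  snoc : ∀ {u v w k} → Walk G u v k → adj v w ≡ true → Walk G u w (suc k)
  snoc [ u ]          e = u ∷⟨ e ⟩ [ _ ]
  snoc (u ∷⟨ e′ ⟩ p) e = u ∷⟨ e′ ⟩ snoc p e

  verts-snoc : ∀ {u v w k} (p : Walk G u v k) (e : adj v w ≡ true) →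
               verts G (snoc p e) ≡ verts G p ++ w ∷ []
  verts-snoc [ u ]          e = refl
  verts-snoc (u ∷⟨ e′ ⟩ p) e = cong (u ∷_) (verts-snoc p e)

  unsnoc : ∀ {u v k} → Walk G u v (suc k) → Σ (Fin m) λ w → Walk G u w k × adj w v ≡ true
  unsnoc (u ∷⟨ e ⟩ [ _ ]) = u , [ u ] , e
  unsnoc (u ∷⟨ e ⟩ p@(_ ∷⟨ _ ⟩ _)) with unsnoc p
  ... | w , q , e′ = w , u ∷⟨ e ⟩ q , e′

  start∈verts : ∀ {u v k} (p : Walk G u v k) → u ∈ verts G p
  start∈verts [ u ]         = here refl
  start∈verts (u ∷⟨ _ ⟩ p) = here refl

  end∈verts : ∀ {u v k} (p : Walk G u v k) → v ∈ verts G p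
  end∈verts [ u ]         = here refl
  end∈verts (u ∷⟨ _ ⟩ p) = there (end∈verts p)

  walk-length-zero : ∀ {u v} → Walk G u v 0 → u ≡ v
  walk-length-zero [ u ] = refl

  closed-path-trivial : ∀ {u k} (p : Walk G u u k) → IsPath G p → ∀ {w} → w ∈ verts G p → w ≡ u
  closed-path-trivial [ u ]         _          (here w≡u) = w≡u
  closed-path-trivial (u ∷⟨ _ ⟩ p) (u∉p ∷ _) _ = contradiction refl (All.lookup u∉p (end∈verts p))

  Dist-unique : ∀ {u v a b} → Dist G u v a → Dist G u v b → a ≡ b
  Dist-unique (p , p-min) (q , q-min) = ℕ.≤-antisym (p-min _ q) (q-min _ p)

module RootedTree (T : Graph m) (acyclic : Acyclic T) (r : Fin m)
    (depth : Fin m → ℕ) (depth-dist : ∀ v → Dist T r v (depth v)) where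
  open Graph T renaming (sym to adj-sym)
  open Walks T
  open Laplacian T using (adjℤ; laplacian-row)

  private variable u v x y z a : Fin m

  adj-flip : adj u v ≡ true → adj v u ≡ true
  adj-flip {u} {v} e = trans (adj-sym v u) e

  depth-minimal : ∀ {k} → Walk T r v k → depth v ≤ k
  depth-minimal {v} p = proj₂ (depth-dist v) _ p

  depth-root : depth r ≡ 0
  depth-root = ℕ.n≤0⇒n≡0 (depth-minimal [ r ])

  depth≡0⇒root : depth v ≡ 0 → v ≡ r
  depth≡0⇒root {v} dv≡0 = sym (walk-length-zero (subst (Walk T r v) dv≡0 (proj₁ (depth-dist v))))

  deeper⇒≢root : ∀ {j} → j < depth v → v ≢ r
  deeper⇒≢root j<dv refl = ℕ.n≮0 (subst (_ <_) depth-root j<dv)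

  depth-adj : adj u v ≡ true → depth v ≤ suc (depth u)
  depth-adj {u} e = depth-minimal (snoc (proj₁ (depth-dist u)) e)

  parentOf : ∀ v → v ≢ r → Σ (Fin m) λ p → adj p v ≡ true × suc (depth p) ≡ depth v
  parentOf v v≢r with depth v in dv | proj₁ (depth-dist v)
  ... | zero  | _        = contradiction (depth≡0⇒root dv) v≢r
  ... | suc k | shortest with unsnoc shortest
  ...   | p , r⇝p , e = p , e , cong suc dp
    where
    dp : depth p ≡ k
    dp = ℕ.≤-antisym (depth-minimal r⇝p) (ℕ.≤-pred (subst (_≤ suc (depth p)) dv (depth-adj e)))

  parent : Fin m → Fin m
  parent v with v ≟ r
  ... | yes _   = r
  ... | no v≢r = proj₁ (parentOf v v≢r)

  parent-adj : v ≢ r → adj (parent v) v ≡ true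
  parent-adj {v} v≢r with v ≟ r
  ... | yes v≡r = contradiction v≡r v≢r
  ... | no v≢r  = proj₁ (proj₂ (parentOf v v≢r))

  depth-parent : v ≢ r → suc (depth (parent v)) ≡ depth v
  depth-parent {v} v≢r with v ≟ r
  ... | yes v≡r = contradiction v≡r v≢r
  ... | no v≢r  = proj₂ (proj₂ (parentOf v v≢r))

  parent-shallower : v ≢ r → depth (parent v) < depth v
  parent-shallower v≢r = ℕ.≤-reflexive (depth-parent v≢r)

  <depth⇒≤depth-parent : ∀ {j} → j < depth v → j ≤ depth (parent v)
  <depth⇒≤depth-parent j<dv =
    ℕ.≤-pred (ℕ.≤-trans j<dv (ℕ.≤-reflexive (sym (depth-parent (deeper⇒≢root j<dv)))))

  ≤depth-parent⇒<depth : ∀ {j} → v ≢ r → j ≤ depth (parent v) → j < depth v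
  ≤depth-parent⇒<depth v≢r j≤dpv = ℕ.<-≤-trans (s≤s j≤dpv) (parent-shallower v≢r)

  parent-≢ : v ≢ r → v ≢ parent v
  parent-≢ v≢r v≡pv = ℕ.1+n≢n (trans (cong (suc ∘ depth) v≡pv) (depth-parent v≢r))

  deeper-distinct : ∀ {k zs} → suc k ≤ depth x → All (λ z → depth z ≤ k) zs → All (x ≢_) zs
  deeper-distinct k<dx = All.map λ { dz≤k refl → ℕ.<⇒≱ k<dx dz≤k }

  ShallowPath : Fin m → Fin m → ℕ → Set
  ShallowPath a b k =
    Σ ℕ λ l → Σ (Walk T a b (suc (suc l))) λ P → IsPath T P × All (λ z → depth z ≤ k) (verts T P)

  -- Two distinct vertices of the same depth are joined through their ancestors; acyclicity turns
  -- this into uniqueness of parents.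
  sameDepth-path : ∀ k {a b} → depth a ≡ k → depth b ≡ k → a ≢ b → ShallowPath a b k
  sameDepth-path zero da db a≢b = contradiction (trans (depth≡0⇒root da) (sym (depth≡0⇒root db))) a≢b
  sameDepth-path (suc k) {a} {b} da db a≢b = via-parents (parent a ≟ parent b)
    where
    a≢r = deeper⇒≢root (ℕ.≤-reflexive (sym da))
    b≢r = deeper⇒≢root (ℕ.≤-reflexive (sym db))
    dpa : depth (parent a) ≡ k
    dpa = ℕ.suc-injective (trans (depth-parent a≢r) da)
    dpb : depth (parent b) ≡ k
    dpb = ℕ.suc-injective (trans (depth-parent b≢r) db)
    a→pa : adj a (parent a) ≡ true
    a→pa = adj-flip (parent-adj a≢r)
    pb→b : adj (parent b) b ≡ true
    pb→b = parent-adj b≢r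

    via-parents : Dec (parent a ≡ parent b) → ShallowPath a b (suc k)
    via-parents (yes pa≡pb) =
      0 , a ∷⟨ a→pa ⟩ (parent a ∷⟨ subst (λ p → adj p b ≡ true) (sym pa≡pb) pb→b ⟩ [ b ]) ,
      (parent-≢ a≢r ∷ a≢b ∷ []) ∷
        ((λ pa≡b → parent-≢ b≢r (trans (sym pa≡b) pa≡pb)) ∷ []) ∷ [] ∷ [] ,
      ℕ.≤-reflexive da ∷ ℕ.m≤n⇒m≤1+n (ℕ.≤-reflexive dpa) ∷ ℕ.≤-reflexive db ∷ []
    via-parents (no pa≢pb) with sameDepth-path k dpa dpb pa≢pb
    ... | l , P , unique , bound = suc (suc l) , a ∷⟨ a→pa ⟩ snoc P pb→b , unique′ , bound′
      where
      unique′ : IsPath T (a ∷⟨ a→pa ⟩ snoc P pb→b)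
      unique′ rewrite verts-snoc P pb→b =
        All.++⁺ (deeper-distinct (ℕ.≤-reflexive (sym da)) bound) (a≢b ∷ []) ∷
        AllPairs.++⁺ unique ([] ∷ [])
          (All.map (λ b≢z → (b≢z ∘ sym) ∷ []) (deeper-distinct (ℕ.≤-reflexive (sym db)) bound))
      bound′ : All (λ z → depth z ≤ suc k) (verts T (a ∷⟨ a→pa ⟩ snoc P pb→b))
      bound′ rewrite verts-snoc P pb→b =
        ℕ.≤-reflexive da ∷ All.++⁺ (All.map ℕ.m≤n⇒m≤1+n bound) (ℕ.≤-reflexive db ∷ [])

  parent-unique : adj u v ≡ true → suc (depth u) ≡ depth v → u ≡ parent v
  parent-unique {u} {v} e du with u ≟ parent v
  ... | yes u≡pv = u≡pv
  ... | no u≢pv with sameDepth-path (depth u) refl (ℕ.suc-injective (trans (depth-parent v≢r) (sym du))) u≢pv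
    where v≢r = deeper⇒≢root (ℕ.≤-reflexive du)
  ...   | l , P , unique , bound =
    contradiction (parent-adj v≢r) (acyclic v (parent v) (suc l) (v ∷⟨ adj-flip e ⟩ P) unique′)
    where
    v≢r = deeper⇒≢root (ℕ.≤-reflexive du)
    unique′ : IsPath T (v ∷⟨ adj-flip e ⟩ P)
    unique′ = deeper-distinct (ℕ.≤-reflexive du) bound ∷ unique

  adj⇒depth≢ : adj x y ≡ true → depth x ≢ depth y
  adj⇒depth≢ {x} {y} e dx≡dy with sameDepth-path (depth x) refl (sym dx≡dy) x≢y
    where x≢y = λ { refl → contradiction (trans (sym e) (irrfl x)) λ () }
  ... | l , P , unique , _ = acyclic x y l P unique (adj-flip e)

  adj⇒parent : adj x y ≡ true → (x ≢ r × y ≡ parent x) ⊎ (y ≢ r × x ≡ parent y)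
  adj⇒parent {x} {y} e with ℕ.<-cmp (depth x) (depth y)
  ... | tri< dx<dy _ _ = inj₂ (deeper⇒≢root dx<dy , parent-unique e (sym dy))
    where dy = ℕ.≤-antisym (depth-adj e) dx<dy
  ... | tri≈ _ dx≡dy _ = contradiction dx≡dy (adj⇒depth≢ e)
  ... | tri> _ _ dy<dx = inj₁ (deeper⇒≢root dy<dx , parent-unique (adj-flip e) (sym dx))
    where dx = ℕ.≤-antisym (depth-adj (adj-flip e)) dy<dx

  depth-iterate : ∀ t v → t ≤ depth v → depth (iterate parent v t) ≡ depth v ∸ t
  depth-iterate zero    v _    = refl
  depth-iterate (suc t) v t<dv = begin
    depth (iterate parent (parent v) t)  ≡⟨ depth-iterate t (parent v) (<depth⇒≤depth-parent t<dv) ⟩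
    depth (parent v) ∸ t                 ≡⟨ cong (_∸ suc t) (depth-parent (deeper⇒≢root t<dv)) ⟩
    depth v ∸ suc t                      ∎
    where open ≡-Reasoning

  iterate-+ : ∀ {A : Set} (f : A → A) x s t → iterate f (iterate f x s) t ≡ iterate f x (s ℕ.+ t)
  iterate-+ f x zero    t = refl
  iterate-+ f x (suc s) t = iterate-+ f (f x) s t

  ancestor : Fin m → ℕ → Fin m
  ancestor v j = iterate parent v (depth v ∸ j)

  depth-ancestor : ∀ {j} → j ≤ depth v → depth (ancestor v j) ≡ j
  depth-ancestor {v} {j} j≤dv =
    trans (depth-iterate (depth v ∸ j) v (ℕ.m∸n≤m (depth v) j)) (ℕ.m∸[m∸n]≡n j≤dv)

  ancestor-self : ∀ v → ancestor v (depth v) ≡ v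
  ancestor-self v = cong (iterate parent v) (ℕ.n∸n≡0 (depth v))

  ancestor-ancestor : ∀ {i j} → i ≤ j → j ≤ depth v → ancestor (ancestor v j) i ≡ ancestor v i
  ancestor-ancestor {v} {i} {j} i≤j j≤dv rewrite depth-ancestor j≤dv =
    trans (iterate-+ parent v (depth v ∸ j) (j ∸ i)) (cong (iterate parent v) steps)
    where
    steps : depth v ∸ j ℕ.+ (j ∸ i) ≡ depth v ∸ i
    steps = trans (sym (ℕ.+-∸-assoc (depth v ∸ j) i≤j)) (cong (_∸ i) (ℕ.m∸n+n≡m j≤dv))

  ancestor-parent : ∀ {j} → j < depth v → ancestor (parent v) j ≡ ancestor v j
  ancestor-parent {v} {j} j<dv = sym (cong (iterate parent v) steps)
    where
    steps : depth v ∸ j ≡ suc (depth (parent v) ∸ j)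
    steps = trans (cong (_∸ j) (sym (depth-parent (deeper⇒≢root j<dv))))
                  (ℕ.+-∸-assoc 1 (<depth⇒≤depth-parent j<dv))

  adj⇒ancestor≡ : ∀ {j} → adj x y ≡ true → j ≤ depth x → j ≤ depth y → ancestor x j ≡ ancestor y j
  adj⇒ancestor≡ e j≤dx j≤dy with adj⇒parent e
  ... | inj₁ (x≢r , refl) = sym (ancestor-parent (≤depth-parent⇒<depth x≢r j≤dy))
  ... | inj₂ (y≢r , refl) = ancestor-parent (≤depth-parent⇒<depth y≢r j≤dx)

  walk-ancestor≡ : ∀ {j l} (P : Walk T x y l) → All (λ z → j ≤ depth z) (verts T P) →
                   ancestor x j ≡ ancestor y j
  walk-ancestor≡ [ x ]         _             = refl
  walk-ancestor≡ (x ∷⟨ e ⟩ P) (j≤dx ∷ deep) =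
    trans (adj⇒ancestor≡ e j≤dx (All.lookup deep (start∈verts P))) (walk-ancestor≡ P deep)

  infix 4 _≼_ _≼?_ _≺_ _≺?_

  _≼_ : Fin m → Fin m → Set
  a ≼ v = depth a ≤ depth v × ancestor v (depth a) ≡ a

  _≼?_ : ∀ a v → Dec (a ≼ v)
  a ≼? v = (depth a ℕ.≤? depth v) ×-dec (ancestor v (depth a) ≟ a)

  _≺_ : Fin m → Fin m → Set
  a ≺ v = depth a < depth v × ancestor v (depth a) ≡ a

  _≺?_ : ∀ a v → Dec (a ≺ v)
  a ≺? v = (depth a ℕ.<? depth v) ×-dec (ancestor v (depth a) ≟ a)

  ≼-refl : ∀ v → v ≼ v
  ≼-refl v = ℕ.≤-refl , ancestor-self v

  ≺⇒≼ : a ≺ v → a ≼ v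
  ≺⇒≼ (da<dv , a≡) = ℕ.<⇒≤ da<dv , a≡

  ≼-trans : x ≼ y → y ≼ z → x ≼ z
  ≼-trans {x} (dx≤dy , x≡) (dy≤dz , y≡) =
    ℕ.≤-trans dx≤dy dy≤dz ,
    trans (sym (ancestor-ancestor dx≤dy dy≤dz)) (trans (cong (λ t → ancestor t (depth x)) y≡) x≡)

  ≼-depth⇒≡ : a ≼ v → depth a ≡ depth v → a ≡ v
  ≼-depth⇒≡ {v = v} (_ , a≡) da≡dv = trans (sym a≡) (trans (cong (ancestor v) da≡dv) (ancestor-self v))

  ancestor-≼ : ∀ {j} → j ≤ depth v → ancestor v j ≼ v
  ancestor-≼ j≤dv rewrite depth-ancestor j≤dv = j≤dv , refl

  parent-≼ : v ≢ r → parent v ≼ v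
  parent-≼ {v} v≢r =
    ℕ.<⇒≤ (parent-shallower v≢r) ,
    trans (sym (ancestor-parent (parent-shallower v≢r))) (ancestor-self (parent v))

  ≼-parent : a ≼ v → depth a < depth v → a ≼ parent v
  ≼-parent (_ , a≡) da<dv = <depth⇒≤depth-parent da<dv , trans (ancestor-parent da<dv) a≡

  -- The subtree of a can only be entered from outside through a itself, so a path with both
  -- ends in that subtree never leaves it.
  child-enters : adj z u ≡ true → a ≼ u → ¬ a ≼ z → u ≡ a
  child-enters {u = u} {a = a} e a≼u a⋠z with adj⇒parent e
  ... | inj₁ (z≢r , refl) = contradiction (≼-trans a≼u (parent-≼ z≢r)) a⋠z
  ... | inj₂ (u≢r , refl) with ℕ.<-cmp (depth a) (depth u)
  ...   | tri< da<du _ _ = contradiction (≼-parent a≼u da<du) a⋠z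
  ...   | tri≈ _ da≡du _ = sym (≼-depth⇒≡ a≼u da≡du)
  ...   | tri> _ _ du<da = contradiction (proj₁ a≼u) (ℕ.<⇒≱ du<da)

  walk-enters : ∀ {l} (P : Walk T z y l) → a ≼ y → ¬ a ≼ z → a ∈ verts T P
  walk-enters [ y ] a≼y a⋠y = contradiction a≼y a⋠y
  walk-enters {a = a} (_∷⟨_⟩_ z {u} e P) a≼y a⋠z with a ≼? u
  ... | yes a≼u = there (subst (_∈ verts T P) (child-enters e a≼u a⋠z) (start∈verts P))
  ... | no a⋠u  = there (walk-enters P a≼y a⋠u)

  path-stays : ∀ {l} (P : Walk T x y l) → IsPath T P → a ≼ x → a ≼ y → All (a ≼_) (verts T P)
  path-stays [ x ] _ a≼x _ = a≼x ∷ []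
  path-stays {a = a} (_∷⟨_⟩_ x {z} e P) (x∉P ∷ unique) a≼x a≼y with a ≼? z
  ... | yes a≼z = a≼x ∷ path-stays P unique a≼z a≼y
  ... | no a⋠z  = contradiction refl (All.lookup x∉P x∈P)
    where
    x∈P : x ∈ verts T P
    x∈P = subst (_∈ verts T P) (sym (child-enters (adj-flip e) a≼x a⋠z)) (walk-enters P a≼y a⋠z)

  CommonAncestorAt : Fin m → Fin m → ℕ → Set
  CommonAncestorAt v k j = j ≤ depth v × j ≤ depth k × ancestor v j ≡ ancestor k j

  MeetDepth : Fin m → Fin m → ℕ → Set
  MeetDepth v k j = CommonAncestorAt v k j × ∀ i → CommonAncestorAt v k i → i ≤ j

  CommonAncestorAt-≤ : ∀ {k} i {j} → i ≤ j → CommonAncestorAt v k j → CommonAncestorAt v k i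
  CommonAncestorAt-≤ i i≤j (j≤dv , j≤dk , same) =
    ℕ.≤-trans i≤j j≤dv , ℕ.≤-trans i≤j j≤dk ,
    trans (sym (ancestor-ancestor i≤j j≤dv))
          (trans (cong (λ t → ancestor t i) same) (ancestor-ancestor i≤j j≤dk))

  MeetDepth-unique : ∀ {k i j} → MeetDepth v k i → MeetDepth v k j → i ≡ j
  MeetDepth-unique (ci , max-i) (cj , max-j) = ℕ.≤-antisym (max-j _ ci) (max-i _ cj)

  MeetDepth-sym : ∀ {k j} → MeetDepth v k j → MeetDepth k v j
  MeetDepth-sym ((j≤dv , j≤dk , same) , max) =
    (j≤dk , j≤dv , sym same) , λ i (i≤dk , i≤dv , same′) → max i (i≤dv , i≤dk , sym same′)

  MeetDepth-root : ∀ k → MeetDepth r k 0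
  MeetDepth-root k =
    (z≤n , z≤n , trans (ancestor₀ r) (sym (ancestor₀ k))) ,
    λ i (i≤dr , _ , _) → subst (i ≤_) depth-root i≤dr
    where
    ancestor₀ : ∀ v → ancestor v 0 ≡ r
    ancestor₀ v = depth≡0⇒root (depth-ancestor z≤n)

  ≼⇒MeetDepth : ∀ {k} → a ≼ k → MeetDepth a k (depth a)
  ≼⇒MeetDepth {a} (da≤dk , a≡) =
    (ℕ.≤-refl , da≤dk , trans (ancestor-self a) (sym a≡)) , λ _ → proj₁

  MeetDepth-parent : ∀ {k j} → x ≢ r → ¬ x ≼ k → MeetDepth x k j → MeetDepth (parent x) k j
  MeetDepth-parent {x} {k} {j} x≢r x⋠k ((j≤dx , j≤dk , same) , max) =
    (<depth⇒≤depth-parent j<dx , j≤dk , trans (ancestor-parent j<dx) same) ,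
    λ i (i≤dpx , i≤dk , same′) →
      let i<dx = ≤depth-parent⇒<depth x≢r i≤dpx
      in max i (ℕ.<⇒≤ i<dx , i≤dk , trans (sym (ancestor-parent i<dx)) same′)
    where
    j≢dx : j ≢ depth x
    j≢dx refl = x⋠k (j≤dk , trans (sym same) (ancestor-self x))
    j<dx : j < depth x
    j<dx = ℕ.≤∧≢⇒< j≤dx j≢dx

  DistToPath⇒MeetDepth : ∀ {k j} → DistToPath T r v k j → MeetDepth v k j
  DistToPath⇒MeetDepth {v} {k} {j} (_ , P , unique , (w , w∈P , dist-w) , nearest) = common , maximal
    where
    deep : All (λ z → j ≤ depth z) (verts T P)
    deep = All.tabulate λ {z} z∈P → nearest z z∈P (depth z) (depth-dist z)
    common : CommonAncestorAt v k j
    common = All.lookup deep (start∈verts P) , All.lookup deep (end∈verts P) , walk-ancestor≡ P deep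
    maximal : ∀ i → CommonAncestorAt v k i → i ≤ j
    maximal i c with i ℕ.≤? j
    ... | yes i≤j = i≤j
    ... | no i≰j with CommonAncestorAt-≤ (suc j) (ℕ.≰⇒> i≰j) c
    ...   | (j<dv , j<dk , same) =
      contradiction (subst₂ _≤_ (depth-ancestor j<dv) (Dist-unique (depth-dist w) dist-w) (proj₁ a≼w))
                    (ℕ.n≮n j)
      where
      a≼w : ancestor v (suc j) ≼ w
      a≼w = All.lookup (path-stays P unique (ancestor-≼ j<dv) (subst (_≼ k) (sym same) (ancestor-≼ j<dk)))
                       w∈P

  δ≡𝟙≼-𝟙≺ : ∀ a v → δ a v ≡ 𝟙 (a ≼? v) - 𝟙 (a ≺? v)
  δ≡𝟙≼-𝟙≺ a v = by-cases (a ≺? v) (a ≼? v)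
    where
    by-cases : Dec (a ≺ v) → Dec (a ≼ v) → δ a v ≡ 𝟙 (a ≼? v) - 𝟙 (a ≺? v)
    by-cases (yes a≺v) _ =
      trans (𝟙-no (a ≟ v) λ { refl → ℕ.<-irrefl refl (proj₁ a≺v) })
            (sym (cong₂ _-_ (𝟙-yes (a ≼? v) (≺⇒≼ a≺v)) (𝟙-yes (a ≺? v) a≺v)))
    by-cases (no a⊀v) (yes a≼v@(da≤dv , a≡)) =
      trans (𝟙-yes (a ≟ v) (≼-depth⇒≡ a≼v da≡dv))
            (sym (cong₂ _-_ (𝟙-yes (a ≼? v) a≼v) (𝟙-no (a ≺? v) a⊀v)))
      where da≡dv = ℕ.≤-antisym da≤dv (ℕ.≮⇒≥ λ da<dv → a⊀v (da<dv , a≡))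
    by-cases (no a⊀v) (no a⋠v) =
      trans (𝟙-no (a ≟ v) λ { refl → a⋠v (≼-refl a) })
            (sym (cong₂ _-_ (𝟙-no (a ≼? v) a⋠v) (𝟙-no (a ≺? v) a⊀v)))

  module _ (k : Fin m) (G : Fin m → ℕ) (meet : ∀ v → MeetDepth v k (G v)) where

    G-step : ∀ x → x ≢ r → + G x - + G (parent x) ≡ 𝟙 (x ≼? k)
    G-step x x≢r with x ≼? k
    ... | yes x≼k = begin
      + G x - + G (parent x)
        ≡⟨ cong₂ (λ a b → + a - + b) Gx Gpx ⟩
      + depth x - + depth (parent x)
        ≡⟨ cong (λ t → + t - + depth (parent x)) (sym (depth-parent x≢r)) ⟩
      + suc (depth (parent x)) - + depth (parent x)
        ≡⟨ suc-minus (depth (parent x)) ⟩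
      1ℤ
        ≡⟨ 𝟙-yes (x ≼? k) x≼k ⟨
      𝟙 (x ≼? k) ∎
      where
      open ≡-Reasoning
      Gx = MeetDepth-unique (meet x) (≼⇒MeetDepth x≼k)
      Gpx = MeetDepth-unique (meet (parent x)) (≼⇒MeetDepth (≼-trans (parent-≼ x≢r) x≼k))
      suc-minus : ∀ p → + suc p - + p ≡ 1ℤ
      suc-minus p =
        trans (ℤ.m-n≡m⊖n (suc p) p) (trans (ℤ.⊖-≥ (ℕ.n≤1+n p)) (cong +_ (ℕ.m+n∸n≡m 1 p)))
    ... | no x⋠k = begin
      + G x - + G (parent x)  ≡⟨ cong (λ g → + G x - + g) Gpx ⟩
      + G x - + G x           ≡⟨ ℤ.+-inverseʳ (+ G x) ⟩
      0ℤ                      ≡⟨ 𝟙-no (x ≼? k) x⋠k ⟨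
      𝟙 (x ≼? k)              ∎
      where
      open ≡-Reasoning
      Gpx = MeetDepth-unique (meet (parent x)) (MeetDepth-parent x≢r x⋠k (meet x))

    module _ (i : Fin m) (i≢r : i ≢ r) where

      towards-k : Fin m
      towards-k = ancestor k (suc (depth i))

      Child : Fin m → Set
      Child j = towards-k ≡ j × i ≺ k

      child? : ∀ j → Dec (Child j)
      child? j = (towards-k ≟ j) ×-dec (i ≺? k)

      towards-k-child : i ≺ k → towards-k ≢ r × parent towards-k ≡ i
      towards-k-child (di<dk , i≡) = c≢r , trans (sym pc≡) (trans (cong (ancestor k) dpc) i≡)
        where
        dc : depth towards-k ≡ suc (depth i)
        dc = depth-ancestor di<dk
        c≢r = deeper⇒≢root (ℕ.≤-reflexive (sym dc))
        pc≡ : ancestor k (depth (parent towards-k)) ≡ parent towards-k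
        pc≡ = proj₂ (≼-trans (parent-≼ c≢r) (ancestor-≼ di<dk))
        dpc : depth (parent towards-k) ≡ depth i
        dpc = ℕ.suc-injective (trans (depth-parent c≢r) dc)

      child-≼⇔ : ∀ j → j ≢ r → parent j ≡ i → j ≼ k ⇔ Child j
      child-≼⇔ j j≢r pj≡i = mk⇔ to from
        where
        dj : depth j ≡ suc (depth i)
        dj = trans (sym (depth-parent j≢r)) (cong (suc ∘ depth) pj≡i)
        to : j ≼ k → Child j
        to j≼k@(dj≤dk , j≡) =
          trans (cong (ancestor k) (sym dj)) j≡ ,
          ℕ.≤-trans (ℕ.≤-reflexive (sym dj)) dj≤dk ,
          subst (λ p → ancestor k (depth p) ≡ p) pj≡i (proj₂ (≼-trans (parent-≼ j≢r) j≼k))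
        from : Child j → j ≼ k
        from (c≡j , di<dk , _) = subst (_≼ k) c≡j (ancestor-≼ di<dk)

      -- Every neighbour of i is its parent or one of its children; only the parent and the child
      -- towards k can contribute.
      edge-term : ∀ j → adjℤ i j * (+ G i - + G j) ≡ δ (parent i) j * 𝟙 (i ≼? k) - 𝟙 (child? j)
      edge-term j with adj i j in e
      ... | false = sym (cong₂ (λ a b → a * 𝟙 (i ≼? k) - b)
                               (𝟙-no (parent i ≟ j) pi≢j) (𝟙-no (child? j) not-child))
        where
        pi≢j : parent i ≢ j
        pi≢j refl = contradiction (trans (sym e) (adj-flip (parent-adj i≢r))) λ ()
        not-child : ¬ Child j
        not-child (refl , i≺k) with towards-k-child i≺k
        ... | c≢r , pc≡i =
          contradiction (trans (sym e) (subst (λ p → adj p towards-k ≡ true) pc≡i (parent-adj c≢r))) λ ()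
      ... | true with adj⇒parent e
      ...   | inj₁ (_ , refl) = begin
        1ℤ * (+ G i - + G (parent i))  ≡⟨ ℤ.*-identityˡ _ ⟩
        + G i - + G (parent i)         ≡⟨ G-step i i≢r ⟩
        𝟙 (i ≼? k)                     ≡⟨ ring (𝟙 (i ≼? k)) ⟩
        1ℤ * 𝟙 (i ≼? k) - 0ℤ
          ≡⟨ cong₂ (λ a b → a * 𝟙 (i ≼? k) - b)
                   (𝟙-yes (parent i ≟ parent i) refl) (𝟙-no (child? (parent i)) not-child) ⟨
        δ (parent i) (parent i) * 𝟙 (i ≼? k) - 𝟙 (child? (parent i)) ∎
        where
        open ≡-Reasoning
        ring : ∀ a → a ≡ 1ℤ * a - 0ℤ
        ring = solve-∀
        not-child : ¬ Child (parent i)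
        not-child (c≡pi , di<dk , _) = ℕ.<-asym (parent-shallower i≢r)
          (subst (λ v → depth i < depth v) c≡pi (ℕ.≤-reflexive (sym (depth-ancestor di<dk))))
      ...   | inj₂ (j≢r , i≡pj) = begin
        1ℤ * (+ G i - + G j)        ≡⟨ ring (+ G i) (+ G j) ⟩
        - (+ G j - + G i)           ≡⟨ cong (λ p → - (+ G j - + G p)) i≡pj ⟩
        - (+ G j - + G (parent j))  ≡⟨ cong -_ (G-step j j≢r) ⟩
        - 𝟙 (j ≼? k)                ≡⟨ cong -_ (𝟙-⇔ (child-≼⇔ j j≢r (sym i≡pj)) (j ≼? k) (child? j)) ⟩
        - 𝟙 (child? j)              ≡⟨ ring′ (𝟙 (i ≼? k)) (𝟙 (child? j)) ⟩
        0ℤ * 𝟙 (i ≼? k) - 𝟙 (child? j)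
          ≡⟨ cong (λ a → a * 𝟙 (i ≼? k) - 𝟙 (child? j)) (𝟙-no (parent i ≟ j) pi≢j) ⟨
        δ (parent i) j * 𝟙 (i ≼? k) - 𝟙 (child? j) ∎
        where
        open ≡-Reasoning
        ring : ∀ a b → 1ℤ * (a - b) ≡ - (b - a)
        ring = solve-∀
        ring′ : ∀ a b → - b ≡ 0ℤ * a - b
        ring′ = solve-∀
        pi≢j : parent i ≢ j
        pi≢j refl = ℕ.<-asym (parent-shallower i≢r)
          (subst (λ v → depth v < depth (parent i)) (sym i≡pj) (parent-shallower j≢r))

      laplacian-meetDepth : sum (λ j → laplacian T i j * + G j) ≡ δ i k
      laplacian-meetDepth = begin
        sum (λ j → laplacian T i j * + G j)
          ≡⟨ laplacian-row i (+_ ∘ G) ⟩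
        sum (λ j → adjℤ i j * (+ G i - + G j))
          ≡⟨ sum-cong-≗ edge-term ⟩
        sum (λ j → δ (parent i) j * 𝟙 (i ≼? k) - 𝟙 (child? j))
          ≡⟨ sum-distrib-- (λ j → δ (parent i) j * 𝟙 (i ≼? k)) (𝟙 ∘ child?) ⟩
        sum (λ j → δ (parent i) j * 𝟙 (i ≼? k)) - sum (𝟙 ∘ child?)
          ≡⟨ cong₂ _-_ (sum-δ (parent i) λ _ → 𝟙 (i ≼? k)) children ⟩
        𝟙 (i ≼? k) - 𝟙 (i ≺? k)
          ≡⟨ δ≡𝟙≼-𝟙≺ i k ⟨
        δ i k ∎
        where
        open ≡-Reasoning
        children : sum (𝟙 ∘ child?) ≡ 𝟙 (i ≺? k)
        children = trans (sum-cong-≗ λ j → 𝟙-×-dec (towards-k ≟ j) (i ≺? k))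
                         (sum-δ towards-k λ _ → 𝟙 (i ≺? k))

withTop : ℕ → (Fin n → ℕ) → Fin (suc n) → ℕ
withTop t f v with view v
... | ‵fromℕ     = t
... | ‵inject₁ i = f i

withTop-inject₁ : ∀ t (f : Fin n → ℕ) i → withTop t f (inject₁ i) ≡ f i
withTop-inject₁ t f i rewrite view-inject₁ i = refl

withTop-fromℕ : ∀ t (f : Fin n → ℕ) → withTop t f (fromℕ n) ≡ t
withTop-fromℕ {n} t f rewrite view-fromℕ n = refl

top-elim : (P : Fin (suc n) → Set) → P (fromℕ n) → (∀ i → P (inject₁ i)) → ∀ v → P v
top-elim P p-top p-inject₁ v with view v
... | ‵fromℕ     = p-top
... | ‵inject₁ i = p-inject₁ i

module ReducedLaplacian (n : ℕ) (T : Graph (suc n)) (acyclic : Acyclic T) (d : Fin n → Fin n → ℕ)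
    (d-path : ∀ i j → DistToPath T (fromℕ n) (inject₁ i) (inject₁ j) (d i j)) where
  open Walks T

  r : Fin (suc n)
  r = fromℕ n

  depth : Fin (suc n) → ℕ
  depth = withTop 0 (λ i → d i i)

  depth-dist : ∀ v → Dist T r v (depth v)
  depth-dist = top-elim (λ v → Dist T r v (depth v))
    (subst (Dist T r r) (sym (withTop-fromℕ 0 (λ i → d i i))) ([ r ] , λ _ _ → z≤n))
    (λ i → subst (Dist T r (inject₁ i)) (sym (withTop-inject₁ 0 (λ i → d i i) i)) (dist-inject₁ i))
    where
    dist-inject₁ : ∀ i → Dist T r (inject₁ i) (d i i)
    dist-inject₁ i with d-path i i
    ... | _ , P , unique , (w , w∈P , dist-w) , _ =
      subst (λ x → Dist T r x (d i i)) (closed-path-trivial P unique w∈P) dist-w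

  open RootedTree T acyclic r depth depth-dist

  L : Fin n → Fin n → ℤ
  L i j = laplacian T (inject₁ i) (inject₁ j)

  L-sym : ∀ i j → L i j ≡ L j i
  L-sym i j = Laplacian.laplacian-sym T (inject₁ i) (inject₁ j)

  d-MeetDepth : ∀ i l → MeetDepth (inject₁ i) (inject₁ l) (d i l)
  d-MeetDepth i l = DistToPath⇒MeetDepth (d-path i l)

  d-sym : ∀ i l → d i l ≡ d l i
  d-sym i l = MeetDepth-unique (MeetDepth-sym (d-MeetDepth i l)) (d-MeetDepth l i)

  L·d≡δ : ∀ i l → sum (λ j → L i j * + d j l) ≡ δ i l
  L·d≡δ i l = begin
    sum (λ j → L i j * + d j l)
      ≡⟨ sum-cong-≗ (λ j → cong (λ t → L i j * + t) (sym (withTop-inject₁ 0 (λ j → d j l) j))) ⟩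
    sum (row ∘ inject₁)
      ≡⟨ ℤ.+-identityʳ (sum (row ∘ inject₁)) ⟨
    sum (row ∘ inject₁) + 0ℤ
      ≡⟨ cong₂ _+_ (refl {x = sum (row ∘ inject₁)}) row-r ⟨
    sum (row ∘ inject₁) + row r
      ≡⟨ sum-init-last row ⟨
    sum row
      ≡⟨ laplacian-meetDepth (inject₁ l) G G-MeetDepth (inject₁ i) (fromℕ≢inject₁ ∘ sym) ⟩
    δ (inject₁ i) (inject₁ l)
      ≡⟨ δ-inject₁ i l ⟩
    δ i l ∎
    where
    open ≡-Reasoning
    G : Fin (suc n) → ℕ
    G = withTop 0 (λ j → d j l)
    G-MeetDepth : ∀ v → MeetDepth v (inject₁ l) (G v)
    G-MeetDepth = top-elim (λ v → MeetDepth v (inject₁ l) (G v))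
      (subst (MeetDepth r (inject₁ l)) (sym (withTop-fromℕ 0 (λ j → d j l))) (MeetDepth-root (inject₁ l)))
      (λ j → subst (MeetDepth (inject₁ j) (inject₁ l)) (sym (withTop-inject₁ 0 (λ j → d j l) j))
                   (d-MeetDepth j l))
    row : Fin (suc n) → ℤ
    row v = laplacian T (inject₁ i) v * + G v
    row-r : row r ≡ 0ℤ
    row-r = trans (cong (λ t → laplacian T (inject₁ i) r * + t) (withTop-fromℕ 0 (λ j → d j l)))
                  (ℤ.*-zeroʳ (laplacian T (inject₁ i) r))

corollary3p2 :
    (n : ℕ) (T : Graph (suc n)) → IsTree T → IsLeaf T (fromℕ n) →
    (d : Fin n → Fin n → ℕ) →
    (∀ i j → DistToPath T (fromℕ n) (inject₁ i) (inject₁ j) (d i j)) →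
    (s : ℤ) →
    BijectionOn {Vec ℤ n} {Vec ℕ n} (ConePoint T s) (ProductPoint (λ i → ∑ℕ (λ j → d i j)) s)
corollary3p2 n T (_ , acyclic) _ d d-path =
  SymmetricInverse.bijection L L-sym d d-sym L·d≡δ
  where open ReducedLaplacian n T acyclic d d-path
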